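{- Let $k \geq 10$ and let $S_1, S_2, \ldots, S_k$ be binary squares, i.e., each $S_i = x_i x_i$ for some nonempty word $x_i \in \{0,1\}^+$. Then the concatenation $S_1 S_2 \cdots S_k$ contains a factor that is an overlap. Moreover, the bound $10$ is optimal: there exists an overlap-free binary word that is a concatenation of $9$ binary squares.
   Context: A word $w$ is a square if $w = xx$ for some nonempty word $x$. A word is an overlap if it has the form $axaxa$ where $a$ is a single letter and $x$ is a (possibly empty) word. A factor of $w$ is a word $y$ such that $w = xyz$ for some words $x, z$. A word is overlap-free if none of its factors is an overlap. -}

module Defs where

open import Data.Bool using (Bool)
open import Data.List using (List; []; _∷_; _++_; [_])
open import Data.Product using (Σ; ∃; _×_; _,_)
open import Relation.Binary.PropositionalEquality using (_≡_; _≢_)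
open import Relation.Nullary using (¬_)

Word : Set
Word = List Bool

IsSquare : Word → Set
IsSquare w = Σ Word λ x → (x ≢ []) × (w ≡ x ++ x)

IsOverlap : Word → Set
IsOverlap w = Σ Bool λ a → Σ Word λ x → w ≡ a ∷ x ++ a ∷ x ++ [ a ]

IsFactor : Word → Word → Set
IsFactor y w = Σ Word λ u → Σ Word λ v → w ≡ u ++ y ++ v

ContainsOverlap : Word → Set
ContainsOverlap w = Σ Word λ y → IsFactor y w × IsOverlap y

OverlapFree : Word → Set
OverlapFree w = ¬ ContainsOverlap w

-- Write a product of ten squares as x₁x₁ W x₁₀x₁₀, where W is the product of the eight middle
-- squares, c is the last letter of x₁ and d the first letter of x₁₀. If the product is
-- overlap-free then so are cW and Wd, and this forces the even-length word W to be, in one of its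
-- two phases, a prefix of an image under the Thue–Morse morphism μ(a) = a ā: either W itself or
-- eW, for a letter e, is a prefix of some μ(V). In the first phase every square xx of W starts at
-- an even position, which forces x = μ(y); then W = μ(W′) where W′ is again a product of eight
-- squares with c̄W′ and W′d overlap-free, and we descend to the shorter W′. In the other phase
-- overlap-freeness leaves only the roots x = ā and x = ā a ā, and a finite search, pruned at the
-- first overlap, shows that eight such squares cannot be bordered by c and d without an overlap.

module Submission where

open import Defs
open import Data.Nat using (ℕ; _≥_)
open import Data.Vec using (Vec)
open import Data.Vec.Relation.Unary.All using (All)
open import Data.List using (List)
open import Data.Bool using (Bool)
open import Data.Product using (Σ; _×_)

open import Data.Bool using (true; false; not; _≟_)
open import Data.Bool.Properties using (not-involutive; not-injective; not-¬; ¬-not)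
open import Data.Empty using (⊥; ⊥-elim)
open import Data.List using ([]; _∷_; _++_; [_]; _∷ʳ_; length; map; replicate)
open import Data.List.Membership.Propositional using (_∈_)
open import Data.List.Properties
  using (++-assoc; ++-identityʳ; ∷-injective; ∷ʳ-injective; length-++; length-map; ++-monoid)
open import Algebra.Solver.Monoid (++-monoid Bool) using (solve; _⊜_; _⊕_)
open import Data.List.Relation.Binary.Pointwise as Pointwise using (Pointwise-≡⇒≡)
open import Data.List.Relation.Binary.Prefix.Heterogeneous using (Prefix; toView; fromView)
  renaming (_++_ to _++ᵛ_)
open import Data.List.Relation.Binary.Prefix.Heterogeneous.Properties using (prefix?)
import Data.List.Relation.Unary.All as ListAll
open ListAll using ([]; _∷_)
import Data.List.Relation.Unary.All.Properties as ListAll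
open import Data.List.Relation.Unary.Any using (here; there)
open import Data.List.Reverse using (reverseView; []; _∶_∶ʳ_)
open import Data.Nat using (zero; suc; _≤_; _<_; z≤n; s≤s; parity)
open import Data.Nat.Induction using (<-wellFounded)
open import Data.Nat.Properties using (m≤n⇒m≤1+n; ≤-trans)
open import Data.Parity using (0ℙ; 1ℙ)
import Data.Parity.Base as ℙ
open import Data.Parity.Properties using (+-homo-+; p+p≡0ℙ)
open import Data.Product using (_,_; ∃; ∃₂)
open import Data.Sum using (_⊎_; inj₁; inj₂)
open import Data.Unit using (⊤; tt)
open import Data.Vec using ([]; _∷_)
import Data.Vec.Relation.Unary.All as VecAll
open VecAll using ([]; _∷_)
import Data.Vec.Relation.Unary.All.Properties as VecAll
open import Function using (_∘_)
open import Induction.WellFounded using (Acc; acc)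
open import Relation.Binary.PropositionalEquality
  using (_≡_; _≢_; refl; sym; trans; cong; cong₂; subst; module ≡-Reasoning)
open import Relation.Nullary using (Dec; yes; no)
open import Relation.Nullary.Decidable using (map′; _⊎-dec_; from-yes; from-no; decidable-stable)

overlapAt : ∀ u a X v → ContainsOverlap (u ++ (a ∷ X ++ a ∷ X ++ [ a ]) ++ v)
overlapAt u a X v = _ , (u , v , refl) , a , X , refl

overlap⇒containsOverlap : ∀ {w} → IsOverlap w → ContainsOverlap w
overlap⇒containsOverlap {w} w-overlap = w , ([] , [] , sym (++-identityʳ w)) , w-overlap

∷-square-overlap : ∀ a u → IsOverlap (a ∷ (u ∷ʳ a) ++ (u ∷ʳ a))
∷-square-overlap a u = a , u , cong (a ∷_) (++-assoc u [ a ] (u ∷ʳ a))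

square-∷ʳ-overlap : ∀ a u → IsOverlap (((a ∷ u) ++ (a ∷ u)) ∷ʳ a)
square-∷ʳ-overlap a u = a , u , ++-assoc (a ∷ u) (a ∷ u) [ a ]

containsOverlap-factor : ∀ {w w′} → IsFactor w w′ → ContainsOverlap w → ContainsOverlap w′
containsOverlap-factor (p , q , refl) (y , (u , v , refl) , y-overlap) = y , (p ++ u , v ++ q , reassoc) , y-overlap
  where
  open ≡-Reasoning
  reassoc : p ++ (u ++ y ++ v) ++ q ≡ (p ++ u) ++ y ++ v ++ q
  reassoc = begin
    p ++ (u ++ y ++ v) ++ q   ≡⟨ cong (p ++_) (++-assoc u (y ++ v) q) ⟩
    p ++ u ++ (y ++ v) ++ q   ≡⟨ cong (λ z → p ++ u ++ z) (++-assoc y v q) ⟩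
    p ++ u ++ y ++ v ++ q     ≡⟨ ++-assoc p u _ ⟨
    (p ++ u) ++ y ++ v ++ q   ∎

overlapFree-factor : ∀ {w w′} → IsFactor w w′ → OverlapFree w′ → OverlapFree w
overlapFree-factor w⊑w′ w′-free = w′-free ∘ containsOverlap-factor w⊑w′

overlapFree-prefix : ∀ w {v} → OverlapFree (w ++ v) → OverlapFree w
overlapFree-prefix w {v} = overlapFree-factor ([] , v , refl)

overlapFree-suffix : ∀ u {w} → OverlapFree (u ++ w) → OverlapFree w
overlapFree-suffix u {w} = overlapFree-factor (u , [] , cong (u ++_) (sym (++-identityʳ w)))

∷ʳ-split : ∀ {A : Set} (L : List A) z K {c C} → L ∷ʳ z ≡ K ++ c ∷ C → ∃ λ C′ → L ≡ K ++ C′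
∷ʳ-split L       z []          eq = L , refl
∷ʳ-split []      z (k ∷ [])    ()
∷ʳ-split []      z (k ∷ _ ∷ _) ()
∷ʳ-split (l ∷ L) z (k ∷ K)     eq
  with refl , eq′ ← ∷-injective eq with C′ , refl ← ∷ʳ-split L z K eq′ = C′ , refl

factor-of-tail : ∀ {a s} p {b O} q → a ∷ s ≡ p ++ b ∷ O ++ q → IsFactor O s
factor-of-tail []      q eq with refl , s≡ ← ∷-injective eq = [] , q , s≡
factor-of-tail (_ ∷ p) {b} {O} q eq with refl , s≡ ← ∷-injective eq =
  p ∷ʳ b , q , trans s≡ (sym (++-assoc p [ b ] (O ++ q)))

factor-of-init : ∀ {s z} p {O} b q → s ∷ʳ z ≡ p ++ O ++ b ∷ q → IsFactor O s
factor-of-init {s} {z} p {O} b q eq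
  with C , refl ← ∷ʳ-split s z (p ++ O) (trans eq (sym (++-assoc p O (b ∷ q)))) = p , C , ++-assoc p O C

-- Deciding whether a word contains an overlap

splits? : ∀ {A : Set} {P : List A → List A → Set} → (∀ u v → Dec (P u v)) →
          ∀ w → Dec (∃₂ λ u v → w ≡ u ++ v × P u v)
splits? P? []      =
  map′ (λ p → [] , [] , refl , p) (λ { ([] , _ , refl , p) → p ; (_ ∷ _ , _ , () , _) }) (P? [] [])
splits? {P = P} P? (a ∷ w) = map′ join split (P? [] (a ∷ w) ⊎-dec splits? (λ u → P? (a ∷ u)) w)
  where
  join : P [] (a ∷ w) ⊎ (∃₂ λ u v → w ≡ u ++ v × P (a ∷ u) v) →
         ∃₂ λ u v → a ∷ w ≡ u ++ v × P u v
  join (inj₁ p)                  = [] , a ∷ w , refl , p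
  join (inj₂ (u , v , refl , p)) = a ∷ u , v , refl , p
  split : (∃₂ λ u v → a ∷ w ≡ u ++ v × P u v) →
          P [] (a ∷ w) ⊎ (∃₂ λ u v → w ≡ u ++ v × P (a ∷ u) v)
  split ([] , _ , refl , p)  = inj₁ p
  split (_ ∷ u , v , eq , p) with refl , w≡ ← ∷-injective eq = inj₂ (u , v , w≡ , p)

-- u ++ t starts with an overlap of period length u.
Continues : Word → Word → Set
Continues []      t = ⊥
Continues (a ∷ X) t = Prefix _≡_ (a ∷ X ∷ʳ a) t

continues? : ∀ u t → Dec (Continues u t)
continues? []      t = no λ ()
continues? (a ∷ X) t = prefix? _≟_ (a ∷ X ∷ʳ a) t

overlap-++-split : ∀ a X v → (a ∷ X ++ a ∷ X ++ [ a ]) ++ v ≡ (a ∷ X) ++ (a ∷ X ∷ʳ a) ++ v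
overlap-++-split a X v =
  solve 3 (λ A X V → (A ⊕ (X ⊕ (A ⊕ (X ⊕ A)))) ⊕ V ⊜ (A ⊕ X) ⊕ (((A ⊕ X) ⊕ A) ⊕ V)) refl [ a ] X v

containsOverlap? : ∀ w → Dec (ContainsOverlap w)
containsOverlap? w = map′ found locate (splits? (λ _ → splits? continues?) w)
  where
  Located : Set
  Located = ∃₂ λ p s → w ≡ p ++ s × ∃₂ λ u t → s ≡ u ++ t × Continues u t
  found : Located → ContainsOverlap w
  found (p , _ , refl , a ∷ X , _ , refl , pre)
    with rs ++ᵛ v ← toView pre with refl ← Pointwise-≡⇒≡ rs =
    _ , (p , v , cong (p ++_) (sym (overlap-++-split a X v))) , a , X , refl
  locate : ContainsOverlap w → Located
  locate (_ , (p , v , refl) , a , X , refl) =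
    p , _ , refl , a ∷ X , _ , overlap-++-split a X v , fromView (Pointwise.refl refl ++ᵛ v)

-- The Thue–Morse morphism

μ : Word → Word
μ []      = []
μ (a ∷ w) = a ∷ not a ∷ μ w

μ-++ : ∀ u v → μ (u ++ v) ≡ μ u ++ μ v
μ-++ []      v = refl
μ-++ (a ∷ u) v = cong (λ w → a ∷ not a ∷ w) (μ-++ u v)

μ-factor : ∀ u y v {w} → w ≡ u ++ y ++ v → μ w ≡ μ u ++ μ y ++ μ v
μ-factor u y v refl = trans (μ-++ u (y ++ v)) (cong (μ u ++_) (μ-++ y v))

μ-lengthens : ∀ a w → length (a ∷ w) < length (μ (a ∷ w))
μ-lengthens a []      = s≤s (s≤s z≤n)
μ-lengthens a (b ∷ w) = s≤s (m≤n⇒m≤1+n (μ-lengthens b w))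

μ-split : ∀ V x {R} → μ V ≡ x ++ R →
          (∃₂ λ y V′ → x ≡ μ y × R ≡ μ V′)
        ⊎ (∃₂ λ y a → ∃ λ V′ → x ≡ μ y ++ [ a ] × R ≡ not a ∷ μ V′)
μ-split V       []          eq = inj₁ ([] , V , refl , sym eq)
μ-split (v ∷ V) (a ∷ [])    eq with refl , eq′ ← ∷-injective eq = inj₂ ([] , a , V , refl , sym eq′)
μ-split (v ∷ V) (a ∷ b ∷ x) eq with refl , eq′ ← ∷-injective eq with refl , eq″ ← ∷-injective eq′
  with μ-split V x eq″
... | inj₁ (y , V′ , refl , R≡)     = inj₁ (a ∷ y , V′ , refl , R≡)
... | inj₂ (y , c , V′ , refl , R≡) = inj₂ (a ∷ y , c , V′ , refl , R≡)

μ-cancelˡ : ∀ y {V R} → μ V ≡ μ y ++ R → ∃ λ V′ → R ≡ μ V′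
μ-cancelˡ []      {V}     eq = V , sym eq
μ-cancelˡ (a ∷ y) {v ∷ V} eq with refl , eq′ ← ∷-injective eq with refl , eq″ ← ∷-injective eq′ =
  μ-cancelˡ y eq″

-- A μ-image starting at an odd position of another μ-image is a power of μ(a) = a ā.
μ-shifted : ∀ y a {S V} → μ y ++ S ≡ a ∷ μ V →
            y ≡ replicate (length y) a × ∃ λ V′ → S ≡ a ∷ μ V′
μ-shifted []      a {V = V}     eq = refl , V , eq
μ-shifted (b ∷ y) a {V = v ∷ V} eq with refl , eq′ ← ∷-injective eq with refl , eq″ ← ∷-injective eq′
  with y≡ , S≡ ← μ-shifted y b (trans eq″ (cong (_∷ μ V) (not-involutive b))) = cong (b ∷_) y≡ , S≡

μ-overlap : ∀ a X →
            μ (a ∷ X ++ a ∷ X ++ [ a ]) ≡ a ∷ not a ∷ μ X ++ a ∷ not a ∷ μ X ++ a ∷ not a ∷ []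
μ-overlap a X = cong (λ w → a ∷ not a ∷ w)
  (trans (μ-++ X (a ∷ X ++ [ a ])) (cong (λ w → μ X ++ a ∷ not a ∷ w) (μ-++ X [ a ])))

μ-overlapˡ : ∀ {y} → IsOverlap y → ∃₂ λ b O → IsOverlap O × μ y ≡ b ∷ O
μ-overlapˡ (a , X , refl) = a , _ , (not a , μ X ++ [ a ] , refl) , trans (μ-overlap a X)
  (solve 3 (λ A N M → A ⊕ (N ⊕ (M ⊕ (A ⊕ (N ⊕ (M ⊕ (A ⊕ N))))))
                    ⊜ A ⊕ (N ⊕ ((M ⊕ A) ⊕ (N ⊕ ((M ⊕ A) ⊕ N)))))
     refl [ a ] [ not a ] (μ X))

μ-overlapʳ : ∀ {y} → IsOverlap y → ∃₂ λ O b → IsOverlap O × μ y ≡ O ∷ʳ b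
μ-overlapʳ (a , X , refl) = _ , not a , (a , not a ∷ μ X , refl) , trans (μ-overlap a X)
  (solve 3 (λ A N M → A ⊕ (N ⊕ (M ⊕ (A ⊕ (N ⊕ (M ⊕ (A ⊕ N))))))
                    ⊜ (A ⊕ ((N ⊕ M) ⊕ (A ⊕ ((N ⊕ M) ⊕ A)))) ⊕ N)
     refl [ a ] [ not a ] (μ X))

overlapFree-μ⁻¹-∷ : ∀ a w → OverlapFree (not a ∷ μ w) → OverlapFree (a ∷ w)
overlapFree-μ⁻¹-∷ a w free (y , (u , v , eq) , y-overlap)
  with b , O , O-overlap , μy≡ ← μ-overlapˡ y-overlap =
  free (O , factor-of-tail (μ u) (μ v) μ-eq , O-overlap)
  where
  μ-eq : a ∷ not a ∷ μ w ≡ μ u ++ b ∷ O ++ μ v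
  μ-eq = trans (μ-factor u y v eq) (cong (λ z → μ u ++ z ++ μ v) μy≡)

overlapFree-μ⁻¹-∷ʳ : ∀ w a → OverlapFree (μ w ∷ʳ a) → OverlapFree (w ∷ʳ a)
overlapFree-μ⁻¹-∷ʳ w a free (y , (u , v , eq) , y-overlap)
  with O , b , O-overlap , μy≡ ← μ-overlapʳ y-overlap =
  free (O , factor-of-init (μ u) b (μ v) μ-eq , O-overlap)
  where
  open ≡-Reasoning
  μ-eq : (μ w ∷ʳ a) ∷ʳ not a ≡ μ u ++ O ++ b ∷ μ v
  μ-eq = begin
    (μ w ∷ʳ a) ∷ʳ not a      ≡⟨ ++-assoc (μ w) [ a ] [ not a ] ⟩
    μ w ++ μ [ a ]           ≡⟨ μ-++ w [ a ] ⟨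
    μ (w ∷ʳ a)               ≡⟨ μ-factor u y v eq ⟩
    μ u ++ μ y ++ μ v        ≡⟨ cong (λ z → μ u ++ z ++ μ v) μy≡ ⟩
    μ u ++ (O ∷ʳ b) ++ μ v   ≡⟨ cong (μ u ++_) (++-assoc O [ b ] (μ v)) ⟩
    μ u ++ O ++ b ∷ μ v      ∎

-- The phase of an overlap-free word

IsPrefixOfμ : Word → Set
IsPrefixOfμ w = ∃₂ λ V r → μ V ≡ w ++ r

IsPrefixOfμ-++ : ∀ {u w} V → u ≡ μ V → IsPrefixOfμ w → IsPrefixOfμ (u ++ w)
IsPrefixOfμ-++ {w = w} V refl (V′ , r , eq) =
  V ++ V′ , r , trans (μ-++ V V′) (trans (cong (μ V ++_) eq) (sym (++-assoc (μ V) w r)))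

IsPrefixOfμ⁻ : Word → Set
IsPrefixOfμ⁻ w = IsPrefixOfμ w ⊎ ∃₂ λ V b → w ≡ μ V ++ b ∷ b ∷ []

μ-∷-IsPrefixOfμ⁻ : ∀ {a w} → IsPrefixOfμ⁻ w → IsPrefixOfμ⁻ (a ∷ not a ∷ w)
μ-∷-IsPrefixOfμ⁻ {a} (inj₁ (V , r , eq)) = inj₁ (a ∷ V , r , cong (λ z → a ∷ not a ∷ z) eq)
μ-∷-IsPrefixOfμ⁻ {a} (inj₂ (V , b , eq)) = inj₂ (a ∷ V , b , cong (λ z → a ∷ not a ∷ z) eq)

data Relative (a : Bool) : Bool → Set where
  same     : Relative a a
  opposite : Relative a (not a)

relative : ∀ a b → Relative a b
relative false false = same
relative false true  = opposite
relative true  false = opposite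
relative true  true  = same

aa-ā-aa-overlap : ∀ e a t R → ContainsOverlap (e ∷ a ∷ a ∷ not a ∷ a ∷ a ∷ t ∷ R)
aa-ā-aa-overlap e a t R with relative a e | relative a t
... | same     | _        = overlapAt [] a [] _
... | _        | same     = overlapAt (e ∷ a ∷ a ∷ not a ∷ []) a [] R
... | opposite | opposite = overlapAt [] (not a) (a ∷ a ∷ []) R

after-repeat     : ∀ e a R → OverlapFree (e ∷ a ∷ a ∷ R) → IsPrefixOfμ⁻ (a ∷ R)
after-repeat-pair : ∀ e a R → OverlapFree (e ∷ a ∷ a ∷ not a ∷ a ∷ R) → IsPrefixOfμ⁻ (a ∷ R)

after-repeat e a []          free = inj₁ ([ a ] , [ not a ] , refl)
after-repeat e a (x ∷ [])    free with relative a x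
... | same     = ⊥-elim (free (overlapAt [ e ] a [] []))
... | opposite = inj₁ ([ a ] , [] , refl)
after-repeat e a (x ∷ y ∷ R) free with relative a x | relative a y
... | same     | _        = ⊥-elim (free (overlapAt [ e ] a [] (y ∷ R)))
... | opposite | opposite =
  μ-∷-IsPrefixOfμ⁻ (after-repeat a (not a) R (overlapFree-suffix (e ∷ a ∷ []) free))
... | opposite | same     = μ-∷-IsPrefixOfμ⁻ (after-repeat-pair e a R free)

after-repeat-pair e a []          free = inj₁ ([ a ] , [ not a ] , refl)
after-repeat-pair e a (z ∷ [])    free with relative a z
... | same     = inj₂ ([] , a , refl)
... | opposite = inj₁ ([ a ] , [] , refl)
after-repeat-pair e a (z ∷ t ∷ R) free with relative a z | relative a t
... | same     | _        = ⊥-elim (free (aa-ā-aa-overlap e a t R))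
... | opposite | same     = ⊥-elim (free (overlapAt (e ∷ a ∷ []) a [ not a ] R))
... | opposite | opposite =
  μ-∷-IsPrefixOfμ⁻ (after-repeat a (not a) R (overlapFree-suffix (e ∷ a ∷ a ∷ not a ∷ []) free))

parity-∷-μ-pair : ∀ a V b → parity (length (a ∷ μ V ++ b ∷ b ∷ [])) ≡ 1ℙ
parity-∷-μ-pair a []      b = refl
parity-∷-μ-pair a (_ ∷ V) b = parity-∷-μ-pair a V b

-- Without a letter after R the last pair cannot be forced (ā a a ā a a is overlap-free);
-- it is excluded by parity instead.
after-repeat-even : ∀ e a R → parity (length R) ≡ 0ℙ → OverlapFree (e ∷ a ∷ a ∷ R) →
                    IsPrefixOfμ (a ∷ R)
after-repeat-even e a R even free with after-repeat e a R free
... | inj₁ prefix       = prefix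
... | inj₂ (V , b , eq)
  with () ← trans (sym (parity-∷-μ-pair a V b)) (trans (cong (parity ∘ length ∘ (a ∷_)) (sym eq)) even)

after-repeat-∷ʳ : ∀ e a R d → OverlapFree (e ∷ a ∷ a ∷ R ∷ʳ d) → IsPrefixOfμ (a ∷ R)
after-repeat-∷ʳ e a R d free with after-repeat e a (R ∷ʳ d) free
... | inj₁ (V , r , eq) = V , d ∷ r , trans eq (++-assoc (a ∷ R) [ d ] r)
... | inj₂ (V , b , eq)
  with a∷R≡ , _ ← ∷ʳ-injective (a ∷ R) (μ V ∷ʳ b) (trans eq (sym (++-assoc (μ V) [ b ] [ b ]))) =
  V ∷ʳ b , [ not b ] ,
  trans (μ-++ V [ b ]) (trans (sym (++-assoc (μ V) [ b ] [ not b ])) (cong (_∷ʳ not b) (sym a∷R≡)))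

after-repeat-bordered : ∀ c d P a R → parity (length (P ++ a ∷ a ∷ R)) ≡ 0ℙ →
                        OverlapFree (c ∷ P ++ a ∷ a ∷ R) → OverlapFree ((P ++ a ∷ a ∷ R) ∷ʳ d) →
                        IsPrefixOfμ (a ∷ R)
after-repeat-bordered c d P a R even c-free d-free with reverseView P
... | []          = after-repeat-even c a R even c-free
... | P′ ∶ _ ∶ʳ e = after-repeat-∷ʳ e a R d (overlapFree-suffix P′ (subst OverlapFree reassoc d-free))
  where
  reassoc : ((P′ ∷ʳ e) ++ a ∷ a ∷ R) ∷ʳ d ≡ P′ ++ e ∷ a ∷ a ∷ R ∷ʳ d
  reassoc = solve 4 (λ P E R D → ((P ⊕ E) ⊕ R) ⊕ D ⊜ P ⊕ (E ⊕ (R ⊕ D)))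
                    refl P′ [ e ] (a ∷ a ∷ R) [ d ]

Alternating : Word → Set
Alternating (a ∷ b ∷ w) = a ≢ b × Alternating (b ∷ w)
Alternating _           = ⊤

firstRepeat : ∀ w → Alternating w
                  ⊎ ∃₂ λ P a → ∃ λ R → w ≡ P ++ a ∷ a ∷ R × Alternating (P ∷ʳ a)
firstRepeat []          = inj₁ tt
firstRepeat (a ∷ [])    = inj₁ tt
firstRepeat (a ∷ b ∷ w) with a ≟ b | firstRepeat (b ∷ w)
... | yes refl | _                           = inj₂ ([] , a , w , refl , tt)
... | no a≢b   | inj₁ alt                    = inj₁ (a≢b , alt)
... | no a≢b   | inj₂ (P , c , R , eq , alt) = inj₂ (a ∷ P , c , R , cong (a ∷_) eq , extend P eq alt)
  where
  extend : ∀ P → b ∷ w ≡ P ++ c ∷ c ∷ R → Alternating (P ∷ʳ c) → Alternating (a ∷ P ∷ʳ c)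
  extend []      eq alt with refl , _ ← ∷-injective eq = a≢b , tt
  extend (_ ∷ _) eq alt with refl , _ ← ∷-injective eq = a≢b , alt

alternating-μ : ∀ u → Alternating u → (∃ λ V → u ≡ μ V) ⊎ (∃₂ λ e V → e ∷ u ≡ μ V)
alternating-μ []          _           = inj₁ ([] , refl)
alternating-μ (b ∷ [])    _           =
  inj₂ (not b , [ not b ] , cong (λ z → not b ∷ z ∷ []) (sym (not-involutive b)))
alternating-μ (b ∷ c ∷ w) (b≢c , alt) with alternating-μ (c ∷ w) alt
... | inj₁ (V , eq) =
  inj₂ (not b , not b ∷ V , cong₂ (λ z u → not b ∷ z ∷ u) (sym (not-involutive b)) eq)
... | inj₂ (e , v ∷ V , eq) with refl , eq′ ← ∷-injective eq with refl , eq″ ← ∷-injective eq′ =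
  inj₁ (v ∷ V , cong₂ (λ z u → z ∷ not v ∷ u) (trans (¬-not b≢c) (not-involutive v)) eq″)

overlapFree-μ-phase : ∀ c d W → parity (length W) ≡ 0ℙ →
                      OverlapFree (c ∷ W) → OverlapFree (W ∷ʳ d) →
                      IsPrefixOfμ W ⊎ ∃ λ e → IsPrefixOfμ (e ∷ W)
overlapFree-μ-phase c d W even c-free d-free with firstRepeat W
... | inj₁ alt with alternating-μ W alt
...   | inj₁ (V , eq)     = inj₁ (V , [] , trans (sym eq) (sym (++-identityʳ W)))
...   | inj₂ (e , V , eq) = inj₂ (e , V , [] , trans (sym eq) (sym (++-identityʳ (e ∷ W))))
overlapFree-μ-phase c d _ even c-free d-free | inj₂ (P , a , R , refl , alt)
  with alternating-μ (P ∷ʳ a) alt | after-repeat-bordered c d P a R even c-free d-free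
... | inj₁ (V , eq)     | tail =
  inj₁ (subst IsPrefixOfμ (++-assoc P [ a ] (a ∷ R)) (IsPrefixOfμ-++ V eq tail))
... | inj₂ (e , V , eq) | tail =
  inj₂ (e , subst IsPrefixOfμ (cong (e ∷_) (++-assoc P [ a ] (a ∷ R))) (IsPrefixOfμ-++ V eq tail))

-- Squares inside μ-images

squares : List Word → Word
squares []       = []
squares (x ∷ xs) = (x ++ x) ++ squares xs

squares-++ : ∀ xs ys → squares (xs ++ ys) ≡ squares xs ++ squares ys
squares-++ []       ys = refl
squares-++ (x ∷ xs) ys =
  trans (cong ((x ++ x) ++_) (squares-++ xs ys)) (sym (++-assoc (x ++ x) (squares xs) (squares ys)))

parity-squares : ∀ xs → parity (length (squares xs)) ≡ 0ℙ
parity-squares []       = refl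
parity-squares (x ∷ xs) = begin
  parity (length ((x ++ x) ++ squares xs))
    ≡⟨ cong parity (length-++ (x ++ x)) ⟩
  parity (length (x ++ x) Data.Nat.+ length (squares xs))
    ≡⟨ +-homo-+ (length (x ++ x)) _ ⟩
  parity (length (x ++ x)) ℙ.+ parity (length (squares xs))
    ≡⟨ cong₂ ℙ._+_ square-even (parity-squares xs) ⟩
  0ℙ
    ∎
  where
  open ≡-Reasoning
  square-even : parity (length (x ++ x)) ≡ 0ℙ
  square-even = begin
    parity (length (x ++ x))                  ≡⟨ cong parity (length-++ x) ⟩
    parity (length x Data.Nat.+ length x)     ≡⟨ +-homo-+ (length x) (length x) ⟩
    parity (length x) ℙ.+ parity (length x)   ≡⟨ p+p≡0ℙ (parity (length x)) ⟩
    0ℙ                                        ∎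

squares-μ : ∀ ys → squares (map μ ys) ≡ μ (squares ys)
squares-μ []       = refl
squares-μ (y ∷ ys) = begin
  (μ y ++ μ y) ++ squares (map μ ys)  ≡⟨ cong ((μ y ++ μ y) ++_) (squares-μ ys) ⟩
  (μ y ++ μ y) ++ μ (squares ys)      ≡⟨ cong (_++ μ (squares ys)) (μ-++ y y) ⟨
  μ (y ++ y) ++ μ (squares ys)        ≡⟨ μ-++ (y ++ y) (squares ys) ⟨
  μ ((y ++ y) ++ squares ys)          ∎
  where open ≡-Reasoning

μ-squares-lengthens : ∀ ys → ListAll.All (_≢ []) ys → 0 < length ys →
                      length (squares ys) < length (squares (map μ ys))
μ-squares-lengthens ([] ∷ _)       ([]≢[] ∷ _) _ = ⊥-elim ([]≢[] refl)
μ-squares-lengthens ((a ∷ y) ∷ ys) _           _ =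
  subst (λ w → length (squares ((a ∷ y) ∷ ys)) < length w) (sym (squares-μ ((a ∷ y) ∷ ys)))
    (μ-lengthens a ((y ++ a ∷ y) ++ squares ys))

-- An odd root x = μ(y) a is followed by ā, so μ(y) sits at an odd position and μ-shifted
-- forces a = ā.
μ-square : ∀ x {V R} → μ V ≡ (x ++ x) ++ R → ∃₂ λ y V′ → x ≡ μ y × R ≡ μ V′
μ-square x {V} {R} eq with μ-split V x (trans eq (++-assoc x x R))
... | inj₁ (y , V₁ , refl , μyR≡) with V′ , R≡ ← μ-cancelˡ y (sym μyR≡) = y , V′ , refl , R≡
... | inj₂ (y , a , V₁ , refl , xR≡)
  with _ , _ , aR≡ ← μ-shifted y (not a) (trans (sym (++-assoc (μ y) [ a ] R)) xR≡)
  with a≡ā , _ ← ∷-injective aR≡ = ⊥-elim (not-¬ refl a≡ā)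

μ-squares : ∀ xs {V r} → μ V ≡ squares xs ++ r → ∃ λ ys → xs ≡ map μ ys
μ-squares []       _  = [] , refl
μ-squares (x ∷ xs) {r = r} eq
  with y , V′ , refl , rest≡ ← μ-square x (trans eq (++-assoc (x ++ x) (squares xs) r))
  with ys , refl ← μ-squares xs (sym rest≡) = y ∷ ys , refl

μ-square-shifted : ∀ e x {V R} → μ V ≡ e ∷ (x ++ x) ++ R → x ≢ [] →
                   (∃ λ k → x ≡ not e ∷ μ (replicate k e) × ∃ λ V′ → R ≡ e ∷ μ V′)
                 ⊎ (∃ λ X → x ≡ (not e ∷ X) ∷ʳ e × ∃ λ V′ → e ∷ R ≡ μ V′)
μ-square-shifted e x {V} {R} eq x≢[] with μ-split V (e ∷ x) (trans eq (cong (e ∷_) (++-assoc x x R)))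
... | inj₁ ([] , _ , () , _)
... | inj₁ (_ ∷ y , [] , e∷x≡ , xR≡) with refl , refl ← ∷-injective e∷x≡ with () ← xR≡
... | inj₁ (_ ∷ y , v ∷ V₁ , e∷x≡ , xR≡)
  with refl , refl ← ∷-injective e∷x≡ with refl , xR≡′ ← ∷-injective xR≡
  with y≡ , V′ , R≡ ← μ-shifted y e (trans xR≡′ (cong (_∷ μ V₁) (not-involutive e))) =
  inj₁ (length y , cong (λ z → not e ∷ μ z) y≡ , V′ , R≡)
... | inj₂ ([] , g , V₁ , e∷x≡ , _) with refl , refl ← ∷-injective e∷x≡ = ⊥-elim (x≢[] refl)
... | inj₂ (_ ∷ y , g , V₁ , e∷x≡ , xR≡)
  with refl , refl ← ∷-injective e∷x≡ with ē≡ , xR≡′ ← ∷-injective xR≡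
  with refl ← not-injective ē≡ =
  inj₂ (μ y , refl , μ-cancelˡ y (sym (trans (sym (++-assoc (μ y) [ e ] R)) xR≡′)))

Block : Bool → Word → Set
Block e x = x ≡ [ not e ] ⊎ x ≡ not e ∷ e ∷ not e ∷ []

blocks : List Word
blocks = [ false ] ∷ [ true ] ∷ (false ∷ true ∷ false ∷ []) ∷ (true ∷ false ∷ true ∷ []) ∷ []

block∈blocks : ∀ {e x} → Block e x → x ∈ blocks
block∈blocks {true}  (inj₁ refl) = here refl
block∈blocks {false} (inj₁ refl) = there (here refl)
block∈blocks {true}  (inj₂ refl) = there (there (here refl))
block∈blocks {false} (inj₂ refl) = there (there (there (here refl)))

block-suffix : ∀ {e x} → Block e x → ∀ S → OverlapFree ((x ++ x) ++ S) → OverlapFree (not e ∷ S)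
block-suffix {e} (inj₁ refl) S = overlapFree-suffix [ not e ]
block-suffix {e} (inj₂ refl) S = overlapFree-suffix (not e ∷ e ∷ not e ∷ not e ∷ e ∷ [])

NeighbourFree : Bool → Word → Word → Set
NeighbourFree e x R = OverlapFree (e ∷ x ++ x)
                    ⊎ ∃₂ λ f R′ → R ≡ f ∷ R′ × OverlapFree ((x ++ x) ∷ʳ f)

neighbourFree⇒overlapFree : ∀ {e x R} → NeighbourFree e x R → OverlapFree x
neighbourFree⇒overlapFree {e} {x} (inj₁ free) = overlapFree-factor ([ e ] , x , refl) free
neighbourFree⇒overlapFree {x = x} (inj₂ (f , _ , _ , free)) =
  overlapFree-factor ([] , x ∷ʳ f , ++-assoc x x [ f ]) free

-- A root of odd length at least 5 starts with the overlap ē e ē e ē; an even root ē X e makes the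
-- square an overlap together with either neighbour.
shifted-block : ∀ e x {V R} → μ V ≡ e ∷ (x ++ x) ++ R → x ≢ [] → NeighbourFree e x R →
                Block e x × ∃ λ V′ → R ≡ e ∷ μ V′
shifted-block e x eq x≢[] free with μ-square-shifted e x eq x≢[]
... | inj₁ (zero , refl , R≡)       = inj₁ refl , R≡
... | inj₁ (suc zero , refl , R≡)   = inj₂ refl , R≡
... | inj₁ (suc (suc k) , refl , _) =
  ⊥-elim (neighbourFree⇒overlapFree free (overlapAt [] (not e) [ e ] (μ (replicate k e))))
... | inj₂ (X , refl , [] , ())
... | inj₂ (X , refl , v ∷ V′ , eR≡) with free
...   | inj₁ e-free = ⊥-elim (e-free (overlap⇒containsOverlap (∷-square-overlap e (not e ∷ X))))
...   | inj₂ (f , R′ , refl , f-free)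
  with refl , fR≡ ← ∷-injective eR≡ with refl , _ ← ∷-injective fR≡ =
  ⊥-elim (f-free (overlap⇒containsOverlap (square-∷ʳ-overlap (not e) (X ∷ʳ e))))

μ-∷-shift : ∀ e {w} V → w ≡ e ∷ μ V → μ (not e ∷ V) ≡ not e ∷ w
μ-∷-shift e V w≡ = cong (not e ∷_) (trans (cong (_∷ μ V) (not-involutive e)) (sym w≡))

shifted-blocksᴸ : ∀ e xs {V r} → μ V ≡ e ∷ squares xs ++ r → OverlapFree (e ∷ squares xs) →
                  ListAll.All (_≢ []) xs → ListAll.All (_∈ blocks) xs
shifted-blocksᴸ e []       _  _    _ = []
shifted-blocksᴸ e (x ∷ xs) {r = r} eq free (x≢[] ∷ ne)
  with x-block , V′ , R≡ ← shifted-block e x (trans eq (cong (e ∷_) (++-assoc (x ++ x) (squares xs) r)))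
                             x≢[] (inj₁ (overlapFree-prefix (e ∷ x ++ x) free)) =
  block∈blocks x-block
    ∷ shifted-blocksᴸ (not e) xs (μ-∷-shift e V′ R≡)
        (block-suffix x-block (squares xs) (overlapFree-suffix [ e ] free)) ne

-- The letter e need not occur in the word, so the first square is checked against its right neighbour.
shifted-blocks : ∀ e xs {V r} → μ V ≡ e ∷ squares xs ++ r → OverlapFree (squares xs) → 2 ≤ length xs →
                 ListAll.All (_≢ []) xs → ListAll.All (_∈ blocks) xs
shifted-blocks e []            _ _ ()       _
shifted-blocks e (x ∷ [])      _ _ (s≤s ()) _
shifted-blocks e (x ∷ [] ∷ xs) _ _ _        (_ ∷ []≢[] ∷ _) = ⊥-elim ([]≢[] refl)
shifted-blocks e (x ∷ ys@((f ∷ _) ∷ _)) {r = r} eq free _ (x≢[] ∷ ne)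
  with x-block , V′ , R≡
       ← shifted-block e x (trans eq (cong (e ∷_) (++-assoc (x ++ x) (squares ys) r))) x≢[]
           (inj₂ (f , _ , refl , overlapFree-prefix ((x ++ x) ∷ʳ f)
                                   (subst OverlapFree (sym (++-assoc (x ++ x) [ f ] _)) free))) =
  block∈blocks x-block ∷ shifted-blocksᴸ (not e) ys (μ-∷-shift e V′ R≡) (block-suffix x-block _ free) ne

-- Refuted c d w n: however the squares of n blocks are appended to w, putting c in front or d
-- behind creates an overlap. Testing c ∷ w at every level prunes the search.
Refuted : Bool → Bool → Word → ℕ → Set
Refuted c d w zero    = ContainsOverlap (c ∷ w) ⊎ ContainsOverlap (w ∷ʳ d)
Refuted c d w (suc n) = ContainsOverlap (c ∷ w) ⊎ ListAll.All (λ x → Refuted c d (w ++ x ++ x) n) blocks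

refuted? : ∀ c d w n → Dec (Refuted c d w n)
refuted? c d w zero    = containsOverlap? (c ∷ w) ⊎-dec containsOverlap? (w ∷ʳ d)
refuted? c d w (suc n) =
  containsOverlap? (c ∷ w) ⊎-dec ListAll.all? (λ x → refuted? c d (w ++ x ++ x) n) blocks

refuted-sound : ∀ {c d} w n → Refuted c d w n → ∀ xs → length xs ≡ n → ListAll.All (_∈ blocks) xs →
                OverlapFree (c ∷ w ++ squares xs) → OverlapFree ((w ++ squares xs) ∷ʳ d) → ⊥
refuted-sound {c} w zero (inj₁ c∷w-overlap) [] _ [] c-free _ =
  c-free (subst (λ z → ContainsOverlap (c ∷ z)) (sym (++-identityʳ w)) c∷w-overlap)
refuted-sound {d = d} w zero (inj₂ w∷d-overlap) [] _ [] _ d-free =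
  d-free (subst (λ z → ContainsOverlap (z ∷ʳ d)) (sym (++-identityʳ w)) w∷d-overlap)
refuted-sound {c} w (suc n) (inj₁ c∷w-overlap) xs _ _ c-free _ = overlapFree-prefix (c ∷ w) c-free c∷w-overlap
refuted-sound {c} {d} w (suc n) (inj₂ refuted) (x ∷ xs) refl (x∈ ∷ xs∈) c-free d-free =
  refuted-sound (w ++ x ++ x) n (ListAll.lookup refuted x∈) xs refl xs∈
    (subst (λ z → OverlapFree (c ∷ z)) reassoc c-free) (subst (λ z → OverlapFree (z ∷ʳ d)) reassoc d-free)
  where
  reassoc : w ++ (x ++ x) ++ squares xs ≡ (w ++ x ++ x) ++ squares xs
  reassoc = sym (++-assoc w (x ++ x) (squares xs))

refuted₈ : ∀ c d → Refuted c d [] 8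
refuted₈ false false = from-yes (refuted? false false [] 8)
refuted₈ false true  = from-yes (refuted? false true  [] 8)
refuted₈ true  false = from-yes (refuted? true  false [] 8)
refuted₈ true  true  = from-yes (refuted? true  true  [] 8)

bordered-squares-overlap : ∀ n → 2 ≤ n → (∀ c d → Refuted c d [] n) →
                           ∀ c d xs → length xs ≡ n → ListAll.All (_≢ []) xs →
                           OverlapFree (c ∷ squares xs) → OverlapFree (squares xs ∷ʳ d) → ⊥
bordered-squares-overlap n 2≤n refuted c d xs len ne = go c xs len ne (<-wellFounded _)
  where
  go : ∀ c xs → length xs ≡ n → ListAll.All (_≢ []) xs → Acc _<_ (length (squares xs)) →
       OverlapFree (c ∷ squares xs) → OverlapFree (squares xs ∷ʳ d) → ⊥
  go c xs len ne (acc shorter) c-free d-free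
    with overlapFree-μ-phase c d (squares xs) (parity-squares xs) c-free d-free
  ... | inj₂ (e , V , r , eq) =
    refuted-sound [] n (refuted c d) xs len
      (shifted-blocks e xs eq (overlapFree-suffix [ c ] c-free) (subst (2 ≤_) (sym len) 2≤n) ne)
      c-free d-free
  ... | inj₁ (V , r , eq) with ys , refl ← μ-squares xs eq =
    go (not c) ys len′ ne′ (shorter (μ-squares-lengthens ys ne′ (subst (0 <_) (sym len′) 0<n)))
      (overlapFree-μ⁻¹-∷ (not c) (squares ys)
        (subst OverlapFree (cong₂ _∷_ (sym (not-involutive c)) (squares-μ ys)) c-free))
      (overlapFree-μ⁻¹-∷ʳ (squares ys) d (subst (λ w → OverlapFree (w ∷ʳ d)) (squares-μ ys) d-free))
    where
    0<n : 0 < n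
    0<n = ≤-trans (s≤s z≤n) 2≤n
    len′ : length ys ≡ n
    len′ = trans (sym (length-map μ ys)) len
    ne′ : ListAll.All (_≢ []) ys
    ne′ = ListAll.map (λ μy≢[] y≡[] → μy≢[] (cong μ y≡[])) (ListAll.map⁻ ne)

ten-squares-overlap : ∀ x₁ mid x₁₀ xs → length mid ≡ 8 →
                      ListAll.All (_≢ []) (x₁ ∷ mid ++ x₁₀ ∷ xs) →
                      ContainsOverlap (squares (x₁ ∷ mid ++ x₁₀ ∷ xs))
ten-squares-overlap x₁ mid []       xs len (_ ∷ ne) = ⊥-elim (ListAll.head (ListAll.++⁻ʳ mid ne) refl)
ten-squares-overlap x₁ mid (d ∷ J) xs len (x₁≢[] ∷ ne) with reverseView x₁
... | []          = ⊥-elim (x₁≢[] refl)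
... | I ∶ _ ∶ʳ c = decidable-stable (containsOverlap? _) λ free →
  bordered-squares-overlap 8 (s≤s (s≤s z≤n)) refuted₈ c d mid len (ListAll.++⁻ˡ mid ne)
    (overlapFree-prefix (c ∷ squares mid) (middle free)) (overlapFree-suffix [ c ] (middle free))
  where
  reassoc : squares ((I ∷ʳ c) ∷ mid ++ (d ∷ J) ∷ xs)
          ≡ ((I ∷ʳ c) ++ I) ++ (c ∷ squares mid ∷ʳ d) ++ J ++ (d ∷ J) ++ squares xs
  reassoc = trans (cong (((I ∷ʳ c) ++ (I ∷ʳ c)) ++_) (squares-++ mid ((d ∷ J) ∷ xs)))
    (solve 6 (λ I C M D J S → ((I ⊕ C) ⊕ (I ⊕ C)) ⊕ (M ⊕ (((D ⊕ J) ⊕ (D ⊕ J)) ⊕ S))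
                             ⊜ ((I ⊕ C) ⊕ I) ⊕ ((C ⊕ (M ⊕ D)) ⊕ (J ⊕ ((D ⊕ J) ⊕ S))))
      refl I [ c ] (squares mid) [ d ] J (squares xs))
  middle : OverlapFree (squares ((I ∷ʳ c) ∷ mid ++ (d ∷ J) ∷ xs)) → OverlapFree (c ∷ squares mid ∷ʳ d)
  middle = overlapFree-factor ((I ∷ʳ c) ++ I , J ++ (d ∷ J) ++ squares xs , reassoc)

squareRoots : ∀ {k} {S : Vec Word k} → All IsSquare S →
              Σ (Vec Word k) λ xs → Data.List.concat (Data.Vec.toList S) ≡ squares (Data.Vec.toList xs)
                                  × ListAll.All (_≢ []) (Data.Vec.toList xs)
squareRoots []                         = [] , refl , []
squareRoots ((x , x≢[] , refl) ∷ sq) with xs , eq , ne ← squareRoots sq =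
  x ∷ xs , cong ((x ++ x) ++_) eq , x≢[] ∷ ne

ten-or-more-squares : (k : ℕ) → k ≥ 10 → (S : Vec Word k) → All IsSquare S →
                      ContainsOverlap (Data.List.concat (Data.Vec.toList S))
ten-or-more-squares _ (s≤s (s≤s (s≤s (s≤s (s≤s (s≤s (s≤s (s≤s (s≤s (s≤s _)))))))))) S sq
  with x₁ ∷ x₂ ∷ x₃ ∷ x₄ ∷ x₅ ∷ x₆ ∷ x₇ ∷ x₈ ∷ x₉ ∷ x₁₀ ∷ xs , eq , ne ← squareRoots sq =
  subst ContainsOverlap (sym eq)
    (ten-squares-overlap x₁ (x₂ ∷ x₃ ∷ x₄ ∷ x₅ ∷ x₆ ∷ x₇ ∷ x₈ ∷ x₉ ∷ []) x₁₀ (Data.Vec.toList xs) refl ne)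

roots₉ : Vec Word 9
roots₉ = (f ∷ f ∷ t ∷ []) ∷ (t ∷ f ∷ []) ∷ (f ∷ t ∷ []) ∷ (t ∷ f ∷ []) ∷ (f ∷ t ∷ t ∷ f ∷ f ∷ t ∷ [])
       ∷ (t ∷ f ∷ []) ∷ (f ∷ t ∷ []) ∷ (t ∷ f ∷ []) ∷ (f ∷ t ∷ t ∷ []) ∷ []
  where
  f = false
  t = true

nine-squares : Σ (Vec Word 9) λ S → All IsSquare S × OverlapFree (Data.List.concat (Data.Vec.toList S))
nine-squares = S₉ , VecAll.map⁺ (VecAll.map (λ x≢[] → _ , x≢[] , refl) nonEmpty)
             , from-no (containsOverlap? (Data.List.concat (Data.Vec.toList S₉)))
  where
  S₉ = Data.Vec.map (λ x → x ++ x) roots₉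
  nonEmpty : All (_≢ []) roots₉
  nonEmpty = (λ ()) ∷ (λ ()) ∷ (λ ()) ∷ (λ ()) ∷ (λ ()) ∷ (λ ()) ∷ (λ ()) ∷ (λ ()) ∷ (λ ()) ∷ []

theorem1 : ((k : ℕ) → k ≥ 10 → (S : Vec Word k) → All IsSquare S
             → ContainsOverlap (Data.List.concat (Data.Vec.toList S)))
           × (Σ (Vec Word 9) λ S → All IsSquare S
             × OverlapFree (Data.List.concat (Data.Vec.toList S)))
theorem1 = ten-or-more-squares , nine-squares
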